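{- Let $G,H$ be connected graphs of orders $n,m$ respectively, and let $k$ be an integer with $3\leq k\leq mn$. Let $S=\{(g_{i_1},h_{j_1}),\ldots,(g_{i_k},h_{j_k})\}$ be a set of $k$ distinct vertices of $G\Box H$, and let $S_G=\{g_{i_1},\ldots,g_{i_k}\}$ and $S_H=\{h_{j_1},\ldots,h_{j_k}\}$ (as multisets). Then $$d_G(S_G)+d_H(S_H)\leq d_{G\Box H}(S)\leq \min\{d_G(S_G)+(k-2)d_H(S_H),\ d_H(S_H)+(k-2)d_G(S_G)\}=d_G(S_G)+d_H(S_H)+(k-3)\min\{d_H(S_H),d_G(S_G)\}.$$
   Context: For a graph $F$ and a set (or multiset) $S$ of vertices of $F$, the Steiner distance $d_F(S)$ is the minimum number of edges of a connected subgraph of $F$ whose vertex set contains every vertex of $S$ ($\infty$ if none exists). The Cartesian product $G\Box H$ has vertex set $V(G)\times V(H)$, with $(g,h)\sim(g',h')$ iff either $g=g'$ and $hh'\in E(H)$, or $h=h'$ and $gg'\in E(G)$. -}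

module Defs where

open import Data.Nat using (ℕ; _≤_)
open import Data.Product using (Σ; Σ-syntax; _×_; _,_; proj₁; proj₂; swap)
open import Data.Sum using (_⊎_; inj₁; inj₂)
open import Data.List using (List; length)
open import Data.List.Membership.Propositional using (_∈_)
open import Data.List.Relation.Unary.All using (All)
open import Data.List.Relation.Unary.AllPairs using (AllPairs)
open import Relation.Binary.PropositionalEquality using (_≡_; _≢_; refl)
open import Relation.Nullary using (¬_)

record Graph (V : Set) : Set₁ where
  field
    Adj   : V → V → Set
    sym   : ∀ {u v} → Adj u v → Adj v u
    irrefl : ∀ {v} → ¬ Adj v v
open Graph public

data Walk {V : Set} (F : Graph V) : V → V → Set where
  here : ∀ {v} → Walk F v v
  step : ∀ {u w v} → Adj F u w → Walk F w v → Walk F u v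

Connected : {V : Set} → Graph V → Set
Connected F = ∀ u v → Walk F u v

ProdAdj : {A B : Set} → Graph A → Graph B → A × B → A × B → Set
ProdAdj G H x y = (proj₁ x ≡ proj₁ y × Adj H (proj₂ x) (proj₂ y))
                ⊎ (proj₂ x ≡ proj₂ y × Adj G (proj₁ x) (proj₁ y))

ProdAdj-sym : {A B : Set} (G : Graph A) (H : Graph B) {x y : A × B} →
  ProdAdj G H x y → ProdAdj G H y x
ProdAdj-sym G H (inj₁ (refl , a)) = inj₁ (refl , sym H a)
ProdAdj-sym G H (inj₂ (refl , a)) = inj₂ (refl , sym G a)

ProdAdj-irrefl : {A B : Set} (G : Graph A) (H : Graph B) {x : A × B} →
  ¬ ProdAdj G H x x
ProdAdj-irrefl G H (inj₁ (_ , a)) = irrefl H a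
ProdAdj-irrefl G H (inj₂ (_ , a)) = irrefl G a

_□_ : {A B : Set} → Graph A → Graph B → Graph (A × B)
G □ H = record { Adj = ProdAdj G H ; sym = ProdAdj-sym G H ; irrefl = ProdAdj-irrefl G H }

data Reach {V : Set} (E : List (V × V)) : V → V → Set where
  here : ∀ {v} → Reach E v v
  step : ∀ {u w v} → ((u , w) ∈ E ⊎ (w , u) ∈ E) → Reach E w v → Reach E u v

DistinctEdge : {V : Set} → V × V → V × V → Set
DistinctEdge e f = e ≢ f × e ≢ swap f

record ConnSubgraph {V : Set} (F : Graph V) : Set where
  field
    W        : List V
    E        : List (V × V)
    edgesAdj : All (λ e → Adj F (proj₁ e) (proj₂ e)) E
    edgesDistinct : AllPairs DistinctEdge E
    edgesIn  : All (λ e → proj₁ e ∈ W × proj₂ e ∈ W) E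
    conn     : ∀ {u v} → u ∈ W → v ∈ W → Reach E u v
open ConnSubgraph public

-- There is a connected subgraph of F with exactly t edges containing
-- every vertex of the (multi)set S, given as a family indexed by I.
HasSteiner : {V I : Set} → Graph V → (I → V) → ℕ → Set
HasSteiner F S t = Σ[ C ∈ ConnSubgraph F ] (length (E C) ≡ t × (∀ i → S i ∈ W C))

SteinerDist : {V I : Set} → Graph V → (I → V) → ℕ → Set
SteinerDist F S d = HasSteiner F S d × (∀ t → HasSteiner F S t → d ≤ t)

module Submission where

-- Every bound is obtained by exhibiting a "connector" of the terminal
-- family: a rooted edge list (repetitions allowed) of the graph from
-- whose root every terminal and every edge is reachable.  Removing
-- repeated edges turns a connector into a connected subgraph, so the
-- Steiner distance is at most the length of any connector.
--
-- Lower bound: project a minimum Steiner subgraph of G □ H to G and to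
-- H, dropping the edges that collapse to a vertex.  Every product edge
-- survives in exactly one projection, so the two projected connectors
-- have d edges in total.
--
-- Upper bound: take a Steiner tree T_G of S_G in one layer G × {c} and,
-- in the fibre {g_i} × H of each terminal, edges of T_H joining c to
-- h_i.  Choosing c as a median of h_1, h_2, h_3 in T_H, the first three
-- fibres together use at most d_H edges (median lemma, proved with
-- simple paths and edge counting), the other k - 3 use d_H edges each.
-- Exchanging the roles of G and H gives the second bound, and the
-- closed form of the minimum is arithmetic.

open import Defs
open import Data.Nat using (ℕ; _+_; _*_; _∸_; _≤_; _⊓_)
open import Data.Fin using (Fin)
open import Data.Product using (_×_; proj₁; proj₂)
open import Function using (_∘_)
open import Function.Definitions using (Injective)
open import Relation.Binary.PropositionalEquality using (_≡_)

open import Data.Nat using (zero; suc; z≤n; s≤s)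
open import Data.Nat.Properties
  using (≤-trans; m≤n⇒m≤1+n; +-mono-≤; +-monoʳ-≤; ≤-reflexive; +-suc; +-assoc; +-comm;
         ⊓-glb; +-distribˡ-⊓; *-distribˡ-⊓; module ≤-Reasoning)
open import Data.Fin using (zero; suc)
import Data.Fin as Fin
open import Data.Product using (_,_; Σ; swap)
open import Data.Product.Properties using (≡-dec)
open import Data.Sum using (_⊎_; inj₁; inj₂)
open import Data.List using (List; []; _∷_; _++_; length; map; allFin; deduplicate)
open import Data.List.Properties using (length-++; length-map; length-deduplicate; length-removeAt′)
open import Data.List.Membership.Propositional using (_∈_; _∉_)
open import Data.List.Membership.Propositional.Properties
  using (∈-++⁺ˡ; ∈-++⁺ʳ; ∈-++⁻; ∈-map⁺; ∈-map⁻; ∈-allFin)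
import Data.List.Membership.DecPropositional as DecMembership
open import Data.List.Relation.Binary.Subset.Propositional using (_⊆_)
open import Data.List.Relation.Unary.Any using (here; there)
import Data.List.Relation.Unary.Any as Any
open Any using (_─_)
import Data.List.Relation.Unary.Any.Properties as AnyP
open import Data.List.Relation.Unary.All as All using (All; []; _∷_)
import Data.List.Relation.Unary.All.Properties as AllP
open import Data.List.Relation.Unary.AllPairs using (AllPairs; []; _∷_)
import Data.List.Relation.Unary.AllPairs.Properties as AllPairsP
open import Relation.Binary.PropositionalEquality using (_≢_; refl; trans; cong; cong₂; subst; module ≡-Reasoning)
  renaming (sym to ≡-sym)
open import Relation.Binary.Definitions using (DecidableEquality; Decidable)
open import Relation.Nullary using (¬_; yes; no; ¬?; _⊎-dec_)
open import Data.Empty using (⊥-elim)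

EdgeIn : {V : Set} → List (V × V) → V → V → Set
EdgeIn E u w = (u , w) ∈ E ⊎ (w , u) ∈ E

EdgeIn-sym : {V : Set} {E : List (V × V)} {u w : V} → EdgeIn E u w → EdgeIn E w u
EdgeIn-sym (inj₁ m) = inj₂ m
EdgeIn-sym (inj₂ m) = inj₁ m

Reach-trans : {V : Set} {E : List (V × V)} {u v w : V} → Reach E u v → Reach E v w → Reach E u w
Reach-trans here q = q
Reach-trans (step e p) q = step e (Reach-trans p q)

Reach-sym : {V : Set} {E : List (V × V)} {u v : V} → Reach E u v → Reach E v u
Reach-sym here = here
Reach-sym (step e p) = Reach-trans (Reach-sym p) (step (EdgeIn-sym e) here)

Reach-mono : {V : Set} {E E' : List (V × V)} → (∀ {a b} → EdgeIn E a b → EdgeIn E' a b) →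
  {u v : V} → Reach E u v → Reach E' u v
Reach-mono f here = here
Reach-mono f (step e p) = step (f e) (Reach-mono f p)

Reach-⊆ : {V : Set} {E E' : List (V × V)} → E ⊆ E' → {u v : V} → Reach E u v → Reach E' u v
Reach-⊆ sub = Reach-mono λ { (inj₁ m) → inj₁ (sub m) ; (inj₂ m) → inj₂ (sub m) }

Within : {V : Set} → List (V × V) → List (V × V) → Set
Within E L = All (λ f → EdgeIn E (proj₁ f) (proj₂ f)) L

Reach-within : {V : Set} {E L : List (V × V)} → Within E L → {u v : V} → Reach L u v → Reach E u v
Reach-within w = Reach-mono λ { (inj₁ m) → All.lookup w m ; (inj₂ m) → EdgeIn-sym (All.lookup w m) }

RootedIn : {V : Set} → List (V × V) → List (V × V) → V → Set
RootedIn T L r = All (λ e → Reach T r (proj₁ e)) L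

Rooted : {V : Set} → List (V × V) → V → Set
Rooted L r = RootedIn L L r

RootedIn-shift : {V : Set} {T L : List (V × V)} {r r' : V} → Reach T r' r → RootedIn T L r → RootedIn T L r'
RootedIn-shift q = All.map (Reach-trans q)

RootedIn-⊆ : {V : Set} {T T' L : List (V × V)} {r : V} → T ⊆ T' → RootedIn T L r → RootedIn T' L r
RootedIn-⊆ sub = All.map (Reach-⊆ sub)

Rooted-∷ : {V : Set} {L : List (V × V)} {u w : V} → Rooted L w → Rooted ((u , w) ∷ L) u
Rooted-∷ c = here ∷ RootedIn-shift (step (inj₁ (here refl)) here) (RootedIn-⊆ there c)

AllAdj : {V : Set} → Graph V → List (V × V) → Set
AllAdj F L = All (λ e → Adj F (proj₁ e) (proj₂ e)) L

subgraph-rooted : {V : Set} {F : Graph V} (C : ConnSubgraph F) {r : V} → r ∈ W C → Rooted (E C) r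
subgraph-rooted C r∈ = All.map (λ ends∈ → conn C r∈ (proj₁ ends∈)) (edgesIn C)

subgraph-adj : {V : Set} {F : Graph V} (C : ConnSubgraph F) {L : List (V × V)} → Within (E C) L → AllAdj F L
subgraph-adj {F = F} C = All.map λ { (inj₁ m) → All.lookup (edgesAdj C) m
                                   ; (inj₂ m) → Graph.sym F (All.lookup (edgesAdj C) m) }

remove-keeps : {X : Set} {y z : X} (L : List X) (p : y ∈ L) → z ∈ L → z ≢ y → z ∈ (L ─ p)
remove-keeps (x ∷ L) (here refl) (here refl) z≢y = ⊥-elim (z≢y refl)
remove-keeps (x ∷ L) (here refl) (there q) z≢y = q
remove-keeps (x ∷ L) (there p) (here refl) z≢y = here refl
remove-keeps (x ∷ L) (there p) (there q) z≢y = there (remove-keeps L p q z≢y)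

-- A list of pairwise distinct (unordered) edges, all of them edges of E,
-- is no longer than E: each edge uses up its own entry of E.
distinct-edges-≤ : {V : Set} (E xs : List (V × V)) → AllPairs DistinctEdge xs → Within E xs → length xs ≤ length E
distinct-edges-≤ E [] _ _ = z≤n
distinct-edges-≤ E (x ∷ xs) (x#xs ∷ xs#) (x∈E ∷ xs∈E) = matched x∈E
  where
  unmatched : ∀ {y z} → y ≡ x ⊎ y ≡ swap x → DistinctEdge x z → z ≢ y × swap z ≢ y
  unmatched (inj₁ refl) (z≢x , z≢x') = (λ { refl → z≢x refl }) , (λ { refl → z≢x' refl })
  unmatched (inj₂ refl) (z≢x , z≢x') = (λ { refl → z≢x' refl }) , (λ { refl → z≢x refl })
  use : ∀ {y} (p : y ∈ E) → y ≡ x ⊎ y ≡ swap x → length (x ∷ xs) ≤ length E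
  use p y~x = subst (suc (length xs) ≤_) (≡-sym (length-removeAt′ E (Any.index p)))
      (s≤s (distinct-edges-≤ (E ─ p) xs xs# (keep x#xs xs∈E)))
    where
    keep : ∀ {zs} → All (DistinctEdge x) zs → Within E zs → Within (E ─ p) zs
    keep [] [] = []
    keep (d ∷ ds) (inj₁ q ∷ qs) = inj₁ (remove-keeps E p q (proj₁ (unmatched y~x d))) ∷ keep ds qs
    keep (d ∷ ds) (inj₂ q ∷ qs) = inj₂ (remove-keeps E p q (proj₂ (unmatched y~x d))) ∷ keep ds qs
  matched : EdgeIn E (proj₁ x) (proj₂ x) → length (x ∷ xs) ≤ length E
  matched (inj₁ p) = use p (inj₁ refl)
  matched (inj₂ p) = use p (inj₂ refl)

SameEdge : {V : Set} → V × V → V × V → Set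
SameEdge e f = e ≡ f ⊎ e ≡ swap f

module Simplify {V : Set} (_≟_ : DecidableEquality V) where

  sameEdge? : Decidable (SameEdge {V})
  sameEdge? e f = ≡-dec _≟_ _≟_ e f ⊎-dec ≡-dec _≟_ _≟_ e (swap f)

  simplify : List (V × V) → List (V × V)
  simplify = deduplicate sameEdge?

  simplify-⊆ : ∀ L → simplify L ⊆ L
  simplify-⊆ L = AnyP.deduplicate⁻ sameEdge?

  simplify-length : ∀ L → length (simplify L) ≤ length L
  simplify-length = length-deduplicate sameEdge?

  simplify-distinct : ∀ L → AllPairs DistinctEdge (simplify L)
  simplify-distinct [] = []
  simplify-distinct (x ∷ L) =
    All.map distinct (AllP.all-filter (¬? ∘ sameEdge? x) (simplify L))
    ∷ AllPairsP.filter⁺ (¬? ∘ sameEdge? x) (simplify-distinct L)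
    where
    distinct : ∀ {y} → ¬ SameEdge x y → DistinctEdge x y
    distinct ne = (λ p → ne (inj₁ p)) , (λ p → ne (inj₂ p))

  simplify-joins : ∀ L {a b} → EdgeIn L a b → EdgeIn (simplify L) a b
  simplify-joins L {a} {b} ab = toEdgeIn (AnyP.deduplicate⁺ sameEdge? respects (fromEdgeIn ab))
    where
    P : V × V → Set
    P f = SameEdge (a , b) f
    respects : ∀ {x y} → SameEdge y x → P x → P y
    respects (inj₁ refl) p = p
    respects (inj₂ refl) (inj₁ p) = inj₂ p
    respects (inj₂ refl) (inj₂ p) = inj₁ p
    fromEdgeIn : EdgeIn L a b → Any.Any P L
    fromEdgeIn (inj₁ m) = Any.map inj₁ m
    fromEdgeIn (inj₂ m) = Any.map (λ eq → inj₂ (cong swap eq)) m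
    toEdgeIn : Any.Any P (simplify L) → EdgeIn (simplify L) a b
    toEdgeIn m with AnyP.Any-⊎⁻ m
    ... | inj₁ m₁ = inj₁ m₁
    ... | inj₂ m₂ = inj₂ (Any.map (cong swap) m₂)

record Connector {V : Set} (F : Graph V) {k : ℕ} (S : Fin k → V) : Set where
  field
    edges     : List (V × V)
    adjacent  : AllAdj F edges
    root      : V
    terminals : ∀ i → Reach edges root (S i)
    rooted    : Rooted edges root
open Connector

module ConnectorBound {V : Set} (_≟_ : DecidableEquality V) {F : Graph V} {k : ℕ} {S : Fin k → V}
                      (P : Connector F S) where
  open Simplify _≟_

  terminalList : List V
  terminalList = map S (allFin k)

  vertices : List V
  vertices = root P ∷ (terminalList ++ map proj₁ (edges P) ++ map proj₂ (edges P))

  vertices-reached : ∀ {u} → u ∈ vertices → Reach (edges P) (root P) u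
  vertices-reached (here refl) = here
  vertices-reached (there m) with ∈-++⁻ terminalList m
  ... | inj₁ m₁ with ∈-map⁻ S m₁
  ...   | i , _ , refl = terminals P i
  vertices-reached (there m) | inj₂ m₂ with ∈-++⁻ (map proj₁ (edges P)) m₂
  ... | inj₁ m₃ with ∈-map⁻ proj₁ m₃
  ...   | e , e∈ , refl = All.lookup (rooted P) e∈
  vertices-reached (there m) | inj₂ m₂ | inj₂ m₃ with ∈-map⁻ proj₂ m₃
  ...   | e , e∈ , refl = Reach-trans (All.lookup (rooted P) e∈) (step (inj₁ e∈) here)

  subgraph : ConnSubgraph F
  subgraph = record
    { W = vertices
    ; E = simplify (edges P)
    ; edgesAdj = All.tabulate (All.lookup (adjacent P) ∘ simplify-⊆ (edges P))
    ; edgesDistinct = simplify-distinct (edges P)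
    ; edgesIn = All.tabulate λ m →
        let e∈ = simplify-⊆ (edges P) m in
        there (∈-++⁺ʳ terminalList (∈-++⁺ˡ (∈-map⁺ proj₁ e∈))) ,
        there (∈-++⁺ʳ terminalList (∈-++⁺ʳ (map proj₁ (edges P)) (∈-map⁺ proj₂ e∈)))
    ; conn = λ u∈ v∈ → Reach-mono (simplify-joins (edges P))
                         (Reach-trans (Reach-sym (vertices-reached u∈)) (vertices-reached v∈))
    }

  steiner-≤ : ∀ {d} → SteinerDist F S d → d ≤ length (edges P)
  steiner-≤ (_ , minimal) =
    ≤-trans (minimal _ (subgraph , refl , λ i → there (∈-++⁺ˡ (∈-map⁺ S (∈-allFin i)))))
            (simplify-length (edges P))

steiner-connector : {V : Set} {F : Graph V} {k : ℕ} {S : Fin (suc k) → V} {t : ℕ} →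
  HasSteiner F S t → Σ (Connector F S) λ P → length (edges P) ≡ t
steiner-connector {S = S} (C , len , S∈) =
  record { edges = E C ; adjacent = edgesAdj C ; root = S zero
         ; terminals = λ i → conn C (S∈ zero) (S∈ i) ; rooted = subgraph-rooted C (S∈ zero) }
  , len

module Image {V V' : Set} (_≟_ : DecidableEquality V') (f : V → V') where

  image : List (V × V) → List (V' × V')
  image [] = []
  image (e ∷ L) with f (proj₁ e) ≟ f (proj₂ e)
  ... | yes _ = image L
  ... | no _ = (f (proj₁ e) , f (proj₂ e)) ∷ image L

  image-length : ∀ L → length (image L) ≤ length L
  image-length [] = z≤n
  image-length (e ∷ L) with f (proj₁ e) ≟ f (proj₂ e)
  ... | yes _ = m≤n⇒m≤1+n (image-length L)
  ... | no _ = s≤s (image-length L)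

  image-∈ : ∀ L {e} → e ∈ L → f (proj₁ e) ≢ f (proj₂ e) → (f (proj₁ e) , f (proj₂ e)) ∈ image L
  image-∈ (x ∷ L) m ne with f (proj₁ x) ≟ f (proj₂ x)
  image-∈ (x ∷ L) (here refl) ne | yes p = ⊥-elim (ne p)
  image-∈ (x ∷ L) (there m) ne | yes p = image-∈ L m ne
  image-∈ (x ∷ L) (here refl) ne | no _ = here refl
  image-∈ (x ∷ L) (there m) ne | no _ = there (image-∈ L m ne)

  image-∈⁻ : ∀ L {e'} → e' ∈ image L → Σ (V × V) λ e → e ∈ L × e' ≡ (f (proj₁ e) , f (proj₂ e))
  image-∈⁻ (x ∷ L) m with f (proj₁ x) ≟ f (proj₂ x)
  image-∈⁻ (x ∷ L) m | yes _ with image-∈⁻ L m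
  ... | e , e∈ , eq = e , there e∈ , eq
  image-∈⁻ (x ∷ L) (here refl) | no _ = x , here refl , refl
  image-∈⁻ (x ∷ L) (there m) | no _ with image-∈⁻ L m
  ... | e , e∈ , eq = e , there e∈ , eq

  image-reach : ∀ L {u v} → Reach L u v → Reach (image L) (f u) (f v)
  image-reach L here = here
  image-reach L (step e p) = Reach-trans (edge e) (image-reach L p)
    where
    edge : ∀ {u w} → EdgeIn L u w → Reach (image L) (f u) (f w)
    edge {u} {w} e with f u ≟ f w
    ... | yes p = subst (Reach (image L) (f u)) p here
    edge (inj₁ m) | no ne = step (inj₁ (image-∈ L m ne)) here
    edge (inj₂ m) | no ne = step (inj₂ (image-∈ L m (ne ∘ ≡-sym))) here

  module _ {F : Graph V} {F' : Graph V'}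
           (hom : ∀ {u v} → Adj F u v → Adj F' (f u) (f v) ⊎ f u ≡ f v) where

    image-adj : ∀ L → AllAdj F L → AllAdj F' (image L)
    image-adj [] [] = []
    image-adj (x ∷ L) (a ∷ as) with f (proj₁ x) ≟ f (proj₂ x)
    ... | yes _ = image-adj L as
    ... | no ne with hom a
    ...   | inj₁ a' = a' ∷ image-adj L as
    ...   | inj₂ eq = ⊥-elim (ne eq)

    image-connector : {k : ℕ} {S : Fin k → V} → Connector F S → Connector F' (f ∘ S)
    image-connector P = record
      { edges = image (edges P)
      ; adjacent = image-adj (edges P) (adjacent P)
      ; root = f (root P)
      ; terminals = λ i → image-reach (edges P) (terminals P i)
      ; rooted = All.tabulate reached }
      where
      reached : ∀ {e'} → e' ∈ image (edges P) → Reach (image (edges P)) (f (root P)) (proj₁ e')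
      reached m with image-∈⁻ (edges P) m
      ... | e , e∈ , refl = image-reach (edges P) (All.lookup (rooted P) e∈)

module LowerBound {A B : Set} (_≟A_ : DecidableEquality A) (_≟B_ : DecidableEquality B)
                  (G : Graph A) (H : Graph B) where

  module π₁ = Image _≟A_ (proj₁ {A = A} {B = λ _ → B})
  module π₂ = Image _≟B_ (proj₂ {A = A} {B = λ _ → B})

  proj₁-hom : ∀ {u v} → Adj (G □ H) u v → Adj G (proj₁ u) (proj₁ v) ⊎ proj₁ u ≡ proj₁ v
  proj₁-hom (inj₁ (eq , _)) = inj₂ eq
  proj₁-hom (inj₂ (_ , a)) = inj₁ a

  proj₂-hom : ∀ {u v} → Adj (G □ H) u v → Adj H (proj₂ u) (proj₂ v) ⊎ proj₂ u ≡ proj₂ v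
  proj₂-hom (inj₁ (_ , a)) = inj₁ a
  proj₂-hom (inj₂ (eq , _)) = inj₂ eq

  -- Each product edge moves exactly one coordinate, so it survives in
  -- exactly one of the two projections.
  projections-length : ∀ L → AllAdj (G □ H) L → length (π₁.image L) + length (π₂.image L) ≡ length L
  projections-length [] [] = refl
  projections-length (x ∷ L) (a ∷ as)
    with proj₁ (proj₁ x) ≟A proj₁ (proj₂ x) | proj₂ (proj₁ x) ≟B proj₂ (proj₂ x)
  projections-length (x ∷ L) (inj₁ (_ , h) ∷ as) | _ | yes q = ⊥-elim (irrefl H (subst (λ z → Adj H z _) q h))
  projections-length (x ∷ L) (inj₂ (_ , g) ∷ as) | yes p | _ = ⊥-elim (irrefl G (subst (λ z → Adj G z _) p g))
  projections-length (x ∷ L) (a ∷ as) | yes _ | no _ = trans (+-suc _ _) (cong suc (projections-length L as))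
  projections-length (x ∷ L) (a ∷ as) | no _ | yes _ = cong suc (projections-length L as)
  projections-length (x ∷ L) (inj₁ (p , _) ∷ as) | no p̸ | no _ = ⊥-elim (p̸ p)
  projections-length (x ∷ L) (inj₂ (q , _) ∷ as) | no _ | no q̸ = ⊥-elim (q̸ q)

  lower-bound : ∀ {k} (s : Fin (suc k) → A × B) {dG dH d : ℕ} →
    SteinerDist G (proj₁ ∘ s) dG → SteinerDist H (proj₂ ∘ s) dH → SteinerDist (G □ H) s d →
    dG + dH ≤ d
  lower-bound s {dG} {dH} sG sH sd with steiner-connector (proj₁ sd)
  ... | P , len = subst (dG + dH ≤_) (trans (projections-length (edges P) (adjacent P)) len)
        (+-mono-≤ (ConnectorBound.steiner-≤ _≟A_ (π₁.image-connector proj₁-hom P) sG)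
                  (ConnectorBound.steiner-≤ _≟B_ (π₂.image-connector proj₂-hom P) sH))

module SimplePaths {V : Set} (_≟_ : DecidableEquality V) (E : List (V × V)) where
  open DecMembership _≟_ using (_∈?_)

  mutual
    data Path : V → V → Set where
      nil : ∀ {v} → Path v v
      cons : ∀ {u w v} → EdgeIn E u w → (p : Path w v) → u ∉ vertices p → Path u v

    vertices : ∀ {u v} → Path u v → List V
    vertices {v = v} nil = v ∷ []
    vertices {u = u} (cons _ p _) = u ∷ vertices p

  pathEdges : ∀ {u v} → Path u v → List (V × V)
  pathEdges nil = []
  pathEdges {u = u} (cons {w = w} _ p _) = (u , w) ∷ pathEdges p

  start∈ : ∀ {u v} (p : Path u v) → u ∈ vertices p
  start∈ nil = here refl
  start∈ (cons _ _ _) = here refl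

  EndsIn : List V → List (V × V) → Set
  EndsIn Xs L = All (λ f → proj₁ f ∈ Xs × proj₂ f ∈ Xs) L

  EndsIn-∷ : ∀ {x Xs L} → EndsIn Xs L → EndsIn (x ∷ Xs) L
  EndsIn-∷ = All.map λ { (a , b) → there a , there b }

  pathEdges-endsIn : ∀ {u v} (p : Path u v) → EndsIn (vertices p) (pathEdges p)
  pathEdges-endsIn nil = []
  pathEdges-endsIn (cons e p _) = (here refl , there (start∈ p)) ∷ EndsIn-∷ (pathEdges-endsIn p)

  fresh-distinct : ∀ {u w : V} {Xs : List V} {L : List (V × V)} → u ∉ Xs → EndsIn Xs L →
    All (DistinctEdge (u , w)) L
  fresh-distinct u∉ = All.map λ { (a , b) → (λ { refl → u∉ a }) , (λ { refl → u∉ b }) }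

  pathEdges-distinct : ∀ {u v} (p : Path u v) → AllPairs DistinctEdge (pathEdges p)
  pathEdges-distinct nil = []
  pathEdges-distinct (cons e p u∉) = fresh-distinct u∉ (pathEdges-endsIn p) ∷ pathEdges-distinct p

  pathEdges-within : ∀ {u v} (p : Path u v) → Within E (pathEdges p)
  pathEdges-within nil = []
  pathEdges-within (cons e p _) = e ∷ pathEdges-within p

  pathEdges-reach : ∀ {u v} (p : Path u v) → Reach (pathEdges p) u v
  pathEdges-reach nil = here
  pathEdges-reach (cons e p _) = step (inj₁ (here refl)) (Reach-⊆ there (pathEdges-reach p))

  pathEdges-rooted : ∀ {u v} (p : Path u v) → Rooted (pathEdges p) u
  pathEdges-rooted nil = []
  pathEdges-rooted (cons e p _) = Rooted-∷ (pathEdges-rooted p)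

  suffix : ∀ {u x v} (p : Path u v) → x ∈ vertices p → Path x v
  suffix nil (here refl) = nil
  suffix (cons e p u∉) (here refl) = cons e p u∉
  suffix (cons e p u∉) (there m) = suffix p m

  toPath : ∀ {u v} → Reach E u v → Path u v
  toPath here = nil
  toPath {u = u} (step e r) with toPath r
  ... | p with u ∈? vertices p
  ...   | yes m = suffix p m
  ...   | no u∉ = cons e p u∉

  record Cut (x c y : V) : Set where
    field
      before after : List (V × V)
      before-within : Within E before
      after-within : Within E after
      before-reach : Reach before c x
      after-reach : Reach after c y
      before-rooted : Rooted before c
      after-rooted : Rooted after c

  cut : ∀ {x y c} (p : Path x y) → c ∈ vertices p →
    Σ (Cut x c y) λ C → Cut.before C ++ Cut.after C ≡ pathEdges p
  cut nil (here refl) = record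
    { before = [] ; after = [] ; before-within = [] ; after-within = []
    ; before-reach = here ; after-reach = here ; before-rooted = [] ; after-rooted = [] } , refl
  cut p@(cons _ _ _) (here refl) = record
    { before = [] ; after = pathEdges p ; before-within = [] ; after-within = pathEdges-within p
    ; before-reach = here ; after-reach = pathEdges-reach p
    ; before-rooted = [] ; after-rooted = pathEdges-rooted p } , refl
  cut {x = x} (cons {w = w} e p _) (there m) with cut p m
  ... | C , eq = record
    { before = (x , w) ∷ before ; after = after
    ; before-within = e ∷ before-within ; after-within = after-within
    ; before-reach = c↝x ; after-reach = after-reach
    ; before-rooted = RootedIn-shift c↝x (Rooted-∷ (RootedIn-shift (Reach-sym before-reach) before-rooted))
    ; after-rooted = after-rooted } , cong ((x , w) ∷_) eq
    where
    open Cut C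
    c↝x : Reach ((x , w) ∷ before) _ x
    c↝x = Reach-trans (Reach-⊆ there before-reach) (step (inj₂ (here refl)) here)

  record Approach (Xs : List V) (z : V) : Set where
    field
      c : V
      c∈ : c ∈ Xs
      segment : List (V × V)
      segment-within : Within E segment
      segment-reach : Reach segment z c
      segment-rooted : Rooted segment z
      segment-distinct : AllPairs DistinctEdge segment
      segment-fresh : All (λ f → proj₁ f ∉ Xs) segment

  -- Built by walking along the path; the second component records that
  -- the segment stays on the path (for distinctness of its edges).
  approach : (Xs : List V) → ∀ {z y} → y ∈ Xs → (q : Path z y) →
    Σ (Approach Xs z) λ a → EndsIn (vertices q) (Approach.segment a)
  approach Xs {z} y∈ q with z ∈? Xs
  ... | yes z∈ = record
    { c = z ; c∈ = z∈ ; segment = [] ; segment-within = [] ; segment-reach = here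
    ; segment-rooted = [] ; segment-distinct = [] ; segment-fresh = [] } , []
  approach Xs y∈ nil | no z∉ = ⊥-elim (z∉ y∈)
  approach Xs {z} y∈ (cons {w = w} e p z∉p) | no z∉ with approach Xs y∈ p
  ... | a , onP = record
    { c = c ; c∈ = c∈ ; segment = (z , w) ∷ segment ; segment-within = e ∷ segment-within
    ; segment-reach = step (inj₁ (here refl)) (Reach-⊆ there segment-reach)
    ; segment-rooted = Rooted-∷ segment-rooted
    ; segment-distinct = fresh-distinct z∉p onP ∷ segment-distinct
    ; segment-fresh = z∉ ∷ segment-fresh }
    , (here refl , there (start∈ p)) ∷ EndsIn-∷ onP
    where open Approach a

record Median {V : Set} (E : List (V × V)) (x y z : V) : Set where
  field
    c : V
    L₀ L₁ L₂ : List (V × V)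
    within₀ : Within E L₀
    within₁ : Within E L₁
    within₂ : Within E L₂
    reach₀ : Reach L₀ c x
    reach₁ : Reach L₁ c y
    reach₂ : Reach L₂ c z
    rooted₀ : Rooted L₀ c
    rooted₁ : Rooted L₁ c
    rooted₂ : Rooted L₂ c
    total : length L₀ + length L₁ + length L₂ ≤ length E

-- Take a simple path P from x to y and follow a simple path from z until
-- it first meets P, at c; cutting P at c gives the three lists, whose
-- edges are pairwise distinct and hence at most |E| in number.
median : {V : Set} (_≟_ : DecidableEquality V) (E : List (V × V)) {x y z : V} →
  Reach E x y → Reach E z x → Median E x y z
median _≟_ E {x} {y} {z} x↝y z↝x = record
  { c = c ; L₀ = before ; L₁ = after ; L₂ = segment
  ; within₀ = before-within ; within₁ = after-within ; within₂ = segment-within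
  ; reach₀ = before-reach ; reach₁ = after-reach ; reach₂ = Reach-sym segment-reach
  ; rooted₀ = before-rooted ; rooted₁ = after-rooted
  ; rooted₂ = RootedIn-shift (Reach-sym segment-reach) segment-rooted
  ; total = ≤-trans (≤-reflexive lengths)
      (distinct-edges-≤ E (pathEdges P ++ segment) distinct
                        (AllP.++⁺ (pathEdges-within P) segment-within)) }
  where
  open SimplePaths _≟_ E
  P : Path x y
  P = toPath x↝y
  A : Approach (vertices P) z
  A = proj₁ (approach (vertices P) (start∈ P) (toPath z↝x))
  open Approach A
  cutP : Σ (Cut x c y) λ C → Cut.before C ++ Cut.after C ≡ pathEdges P
  cutP = cut P c∈
  open Cut (proj₁ cutP)
  -- The path edges are distinct among themselves (P is simple), the
  -- segment edges likewise, and the two kinds differ since segment edges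
  -- start off the path.
  distinct : AllPairs DistinctEdge (pathEdges P ++ segment)
  distinct = AllPairsP.++⁺ (pathEdges-distinct P) segment-distinct
    (All.map (λ { (a , b) → All.map (λ u∉ → (λ { refl → u∉ a }) , (λ { refl → u∉ b })) segment-fresh })
             (pathEdges-endsIn P))
  lengths : length before + length after + length segment ≡ length (pathEdges P ++ segment)
  lengths = begin
    length before + length after + length segment ≡⟨ cong (_+ length segment) (≡-sym (length-++ before)) ⟩
    length (before ++ after) + length segment    ≡⟨ cong (λ l → length l + length segment) (proj₂ cutP) ⟩
    length (pathEdges P) + length segment        ≡⟨ ≡-sym (length-++ (pathEdges P)) ⟩
    length (pathEdges P ++ segment)              ∎
    where open ≡-Reasoning

mapEdges : {V V' : Set} → (V → V') → List (V × V) → List (V' × V')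
mapEdges f = map (λ e → (f (proj₁ e) , f (proj₂ e)))

mapEdges-reach : {V V' : Set} (f : V → V') {L : List (V × V)} {u v : V} →
  Reach L u v → Reach (mapEdges f L) (f u) (f v)
mapEdges-reach f here = here
mapEdges-reach f (step (inj₁ m) p) = step (inj₁ (∈-map⁺ _ m)) (mapEdges-reach f p)
mapEdges-reach f (step (inj₂ m) p) = step (inj₂ (∈-map⁺ _ m)) (mapEdges-reach f p)

mapEdges-rooted : {V V' : Set} (f : V → V') {L : List (V × V)} {r : V} →
  Rooted L r → Rooted (mapEdges f L) (f r)
mapEdges-rooted f c = AllP.map⁺ (All.map (mapEdges-reach f) c)

mapEdges-adj : {V V' : Set} {F : Graph V} {F' : Graph V'} (f : V → V') →
  (∀ {u v} → Adj F u v → Adj F' (f u) (f v)) → {L : List (V × V)} → AllAdj F L → AllAdj F' (mapEdges f L)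
mapEdges-adj f hom a = AllP.map⁺ (All.map hom a)

module Layered {A B : Set} (G : Graph A) (H : Graph B) where

  layer : B → List (A × A) → List ((A × B) × (A × B))
  layer y = mapEdges (_, y)

  fibre : A → List (B × B) → List ((A × B) × (A × B))
  fibre x = mapEdges (x ,_)

  layer-adj : ∀ y {L} → AllAdj G L → AllAdj (G □ H) (layer y L)
  layer-adj y = mapEdges-adj {F = G} {F' = G □ H} (_, y) λ g → inj₂ (refl , g)

  fibre-adj : ∀ x {L} → AllAdj H L → AllAdj (G □ H) (fibre x L)
  fibre-adj x = mapEdges-adj {F = H} {F' = G □ H} (x ,_) λ h → inj₁ (refl , h)

  fibres : ∀ {k} → (Fin k → A) → (Fin k → List (B × B)) → List ((A × B) × (A × B))
  fibres {zero} a L = []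
  fibres {suc k} a L = fibre (a zero) (L zero) ++ fibres (a ∘ suc) (L ∘ suc)

  fibre-⊆ : ∀ {k} (a : Fin k → A) L i → fibre (a i) (L i) ⊆ fibres a L
  fibre-⊆ a L zero = ∈-++⁺ˡ
  fibre-⊆ a L (suc i) = ∈-++⁺ʳ (fibre (a zero) (L zero)) ∘ fibre-⊆ (a ∘ suc) (L ∘ suc) i

  fibre-length : ∀ x L {R} → length (fibre x L ++ R) ≡ length L + length R
  fibre-length x L {R} = trans (length-++ (fibre x L)) (cong (_+ length R) (length-map _ L))

  fibres-length : ∀ {k} (a : Fin k → A) L {t} → (∀ i → length (L i) ≤ t) → length (fibres a L) ≤ k * t
  fibres-length {zero} a L bound = z≤n
  fibres-length {suc k} a L bound = subst (_≤ suc k * _) (≡-sym (fibre-length (a zero) (L zero)))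
    (+-mono-≤ (bound zero) (fibres-length (a ∘ suc) (L ∘ suc) (bound ∘ suc)))

  fibres-adj : ∀ {k} (a : Fin k → A) L → (∀ i → AllAdj H (L i)) → AllAdj (G □ H) (fibres a L)
  fibres-adj {zero} a L adj = []
  fibres-adj {suc k} a L adj = AllP.++⁺ (fibre-adj (a zero) (adj zero)) (fibres-adj (a ∘ suc) (L ∘ suc) (adj ∘ suc))

  fibres-rooted : ∀ {k} (a : Fin k → A) L {c ρ T} → fibres a L ⊆ T →
    (∀ i → Reach T ρ (a i , c)) → (∀ i → Rooted (L i) c) → RootedIn T (fibres a L) ρ
  fibres-rooted {zero} a L sub reach rooted = []
  fibres-rooted {suc k} a L sub reach rooted = AllP.++⁺
    (RootedIn-shift (reach zero) (RootedIn-⊆ (sub ∘ ∈-++⁺ˡ) (mapEdges-rooted (a zero ,_) (rooted zero))))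
    (fibres-rooted (a ∘ suc) (L ∘ suc) (sub ∘ ∈-++⁺ʳ _) (reach ∘ suc) (rooted ∘ suc))

  layered-connector : ∀ {k} (a : Fin k → A) (b : Fin k → B) {r : A} {c : B} →
    (EG : List (A × A)) → AllAdj G EG → Rooted EG r → (∀ i → Reach EG r (a i)) →
    (L : Fin k → List (B × B)) → (∀ i → AllAdj H (L i)) → (∀ i → Rooted (L i) c) →
    (∀ i → Reach (L i) c (b i)) →
    Connector (G □ H) (λ i → (a i , b i))
  layered-connector a b {r} {c} EG adjG rootedG reachG L adjH rootedH reachH = record
    { edges = T
    ; adjacent = AllP.++⁺ (layer-adj c adjG) (fibres-adj a L adjH)
    ; root = (r , c)
    ; terminals = λ i → Reach-trans (toFibre i)
                          (Reach-⊆ (∈-++⁺ʳ (layer c EG) ∘ fibre-⊆ a L i) (mapEdges-reach (a i ,_) (reachH i)))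
    ; rooted = AllP.++⁺ (RootedIn-⊆ ∈-++⁺ˡ (mapEdges-rooted (_, c) rootedG))
                        (fibres-rooted a L (∈-++⁺ʳ (layer c EG)) toFibre rootedH)
    }
    where
    T : List ((A × B) × (A × B))
    T = layer c EG ++ fibres a L
    toFibre : ∀ i → Reach T (r , c) (a i , c)
    toFibre i = Reach-⊆ ∈-++⁺ˡ (mapEdges-reach (_, c) (reachG i))

module UpperBound {A B : Set} (_≟B_ : DecidableEquality B) (G : Graph A) (H : Graph B) where
  open Layered G H

  -- With c a median of b 0, b 1, b 2 in T_H, the fibres over the first
  -- three terminals use the median lists and the others a full copy of T_H.
  upper-bound : ∀ {k} (s : Fin (3 + k) → A × B) {dG dH : ℕ} →
    HasSteiner G (proj₁ ∘ s) dG → HasSteiner H (proj₂ ∘ s) dH →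
    Σ (Connector (G □ H) s) λ P → length (edges P) ≤ dG + suc k * dH
  upper-bound {k} s {dG} {dH} (CG , lenG , a∈) (CH , lenH , b∈) =
    layered-connector a b (E CG) (edgesAdj CG) (subgraph-rooted CG (a∈ zero)) (λ i → conn CG (a∈ zero) (a∈ i))
                      L (subgraph-adj CH ∘ fibreWithin) fibreRooted fibreReach
    , length-bound
    where
    a : Fin (3 + k) → A
    a = proj₁ ∘ s
    b : Fin (3 + k) → B
    b = proj₂ ∘ s
    M : Median (E CH) (b zero) (b (suc zero)) (b (suc (suc zero)))
    M = median _≟B_ (E CH) (conn CH (b∈ zero) (b∈ (suc zero))) (conn CH (b∈ (suc (suc zero))) (b∈ zero))
    open Median M
    c↝b₀ : Reach (E CH) c (b zero)
    c↝b₀ = Reach-within within₀ reach₀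
    L : Fin (3 + k) → List (B × B)
    L zero = L₀
    L (suc zero) = L₁
    L (suc (suc zero)) = L₂
    L (suc (suc (suc _))) = E CH
    fibreWithin : ∀ i → Within (E CH) (L i)
    fibreWithin zero = within₀
    fibreWithin (suc zero) = within₁
    fibreWithin (suc (suc zero)) = within₂
    fibreWithin (suc (suc (suc _))) = All.tabulate inj₁
    fibreRooted : ∀ i → Rooted (L i) c
    fibreRooted zero = rooted₀
    fibreRooted (suc zero) = rooted₁
    fibreRooted (suc (suc zero)) = rooted₂
    fibreRooted (suc (suc (suc _))) = RootedIn-shift c↝b₀ (subgraph-rooted CH (b∈ zero))
    fibreReach : ∀ i → Reach (L i) c (b i)
    fibreReach zero = reach₀
    fibreReach (suc zero) = reach₁
    fibreReach (suc (suc zero)) = reach₂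
    fibreReach (suc (suc (suc j))) = Reach-trans c↝b₀ (conn CH (b∈ zero) (b∈ (suc (suc (suc j)))))
    rest : List ((A × B) × (A × B))
    rest = fibres (λ j → a (suc (suc (suc j)))) (λ j → L (suc (suc (suc j))))
    fibres-split : length (fibres a L) ≡ length L₀ + (length L₁ + (length L₂ + length rest))
    fibres-split = trans (fibre-length (a zero) L₀) (cong (length L₀ +_)
                     (trans (fibre-length (a (suc zero)) L₁) (cong (length L₁ +_)
                       (fibre-length (a (suc (suc zero))) L₂))))
    rest-length : length rest ≤ k * dH
    rest-length = fibres-length (λ j → a (suc (suc (suc j)))) (λ j → L (suc (suc (suc j)))) (λ _ → ≤-reflexive lenH)
    length-bound : length (layer c (E CG) ++ fibres a L) ≤ dG + suc k * dH
    length-bound = begin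
      length (layer c (E CG) ++ fibres a L)
        ≡⟨ trans (length-++ (layer c (E CG))) (cong₂ _+_ (trans (length-map _ (E CG)) lenG) fibres-split) ⟩
      dG + (length L₀ + (length L₁ + (length L₂ + length rest)))
        ≡⟨ cong (dG +_) (trans (≡-sym (+-assoc (length L₀) _ _)) (≡-sym (+-assoc (length L₀ + length L₁) _ _))) ⟩
      dG + ((length L₀ + length L₁ + length L₂) + length rest)
        ≤⟨ +-monoʳ-≤ dG (+-mono-≤ (subst (length L₀ + length L₁ + length L₂ ≤_) lenH total) rest-length) ⟩
      dG + suc k * dH ∎
      where open ≤-Reasoning

swap-hom : {A B : Set} (G : Graph A) (H : Graph B) {u v : B × A} →
  Adj (H □ G) u v → Adj (G □ H) (swap u) (swap v) ⊎ swap u ≡ swap v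
swap-hom G H (inj₁ (eq , a)) = inj₁ (inj₂ (eq , a))
swap-hom G H (inj₂ (eq , a)) = inj₁ (inj₁ (eq , a))

min-closed-form : ∀ (a b k : ℕ) → (a + suc k * b) ⊓ (b + suc k * a) ≡ a + b + k * (b ⊓ a)
min-closed-form a b k = begin
  (a + (b + k * b)) ⊓ (b + (a + k * a)) ≡⟨ cong₂ _⊓_ (≡-sym (+-assoc a b _))
                                                     (trans (≡-sym (+-assoc b a _)) (cong (_+ k * a) (+-comm b a))) ⟩
  (a + b + k * b) ⊓ (a + b + k * a)     ≡⟨ ≡-sym (+-distribˡ-⊓ (a + b) _ _) ⟩
  a + b + (k * b) ⊓ (k * a)             ≡⟨ cong (a + b +_) (≡-sym (*-distribˡ-⊓ k b a)) ⟩
  a + b + k * (b ⊓ a)                   ∎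
  where open ≡-Reasoning

corollary2p1 : ∀ {n m : ℕ} (G : Graph (Fin n)) (H : Graph (Fin m)) →
    Connected G → Connected H →
    (k : ℕ) → 3 ≤ k → k ≤ m * n →
    (s : Fin k → Fin n × Fin m) → Injective _≡_ _≡_ s →
    (dG dH d : ℕ) →
    SteinerDist G (proj₁ ∘ s) dG → SteinerDist H (proj₂ ∘ s) dH →
    SteinerDist (G □ H) s d →
    (dG + dH ≤ d)
    × (d ≤ (dG + (k ∸ 2) * dH) ⊓ (dH + (k ∸ 2) * dG))
    × ((dG + (k ∸ 2) * dH) ⊓ (dH + (k ∸ 2) * dG) ≡ dG + dH + (k ∸ 3) * (dH ⊓ dG))
corollary2p1 G H _ _ (suc (suc (suc k))) (s≤s (s≤s (s≤s _))) _ s _ dG dH d sG sH sd =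
  LowerBound.lower-bound Fin._≟_ Fin._≟_ G H s sG sH sd
  , ⊓-glb throughG throughH
  , min-closed-form dG dH k
  where
  open ConnectorBound (≡-dec Fin._≟_ Fin._≟_) using (steiner-≤)
  throughG : d ≤ dG + suc k * dH
  throughG with UpperBound.upper-bound Fin._≟_ G H s (proj₁ sG) (proj₁ sH)
  ... | P , len = ≤-trans (steiner-≤ P sd) len
  throughH : d ≤ dH + suc k * dG
  throughH with UpperBound.upper-bound Fin._≟_ H G (swap ∘ s) (proj₁ sH) (proj₁ sG)
  ... | P , len = ≤-trans (steiner-≤ (image-connector (swap-hom G H) P) sd)
                          (≤-trans (image-length (edges P)) len)
    where open Image (≡-dec Fin._≟_ Fin._≟_) swap
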